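{- Let $G$ be a graph and $T$ a tree, each with a vertex labeled $v$, and let $G\stackrel{v}{+}T$ be their vertex-sum at $v$. Then $Z_+(G\stackrel{v}{+}T)=Z_+(G)$ and $\mathrm{T}(G\stackrel{v}{+}T)=\mathrm{T}(G)$.
   Context: All graphs are finite, simple and undirected. Positive semidefinite colour change rule: vertices are coloured black or white; let $B$ be the set of black vertices and $W_1,\dots,W_r$ the vertex sets of the components of $G-B$; if $u\in B$ and $w\in W_i$ is the only white neighbour of $u$ in the subgraph induced by $B\cup W_i$, then $w$ is recoloured black. A positive zero forcing set is a set of initially black vertices (all others white) from which repeated application of this rule colours all vertices black; $Z_+(G)$ is the minimum size of such a set. The tree cover number $\mathrm{T}(G)$ is the minimum number of vertex-disjoint induced trees of $G$ covering $V(G)$. The vertex-sum $G\stackrel{v}{+}H$ is obtained from disjoint copies of $G$ and $H$ by identifying their vertices labeled $v$. -}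

module Defs where

open import Data.Nat using (ℕ; zero; suc; _+_; _≤_)
open import Data.Bool using (Bool; true; false; _∨_; if_then_else_)
open import Data.Fin using (Fin; zero; suc; splitAt; punchIn; inject₁; fromℕ)
open import Data.Fin.Properties using (_≟_)
open import Data.Fin.Subset using (Subset; _∈_; _∉_; _∪_; ⁅_⁆; ⊤; ∣_∣)
open import Data.Maybe using (Maybe; just; nothing)
open import Data.Sum using (inj₁; inj₂)
open import Data.Product using (Σ; ∃; ∃-syntax; _×_; _,_)
open import Data.Unit using () renaming (⊤ to Unit)
open import Data.Empty using (⊥)
open import Relation.Nullary using (¬_; yes; no)
open import Relation.Binary.PropositionalEquality using (_≡_; refl; cong₂)
open import Function.Definitions using (Injective)

record Graph (n : ℕ) : Set where
  field
    adj    : Fin n → Fin n → Bool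
    sym    : ∀ i j → adj i j ≡ adj j i
    irrefl : ∀ i → adj i i ≡ false
open Graph public

Adj : ∀ {n} → Graph n → Fin n → Fin n → Set
Adj G x y = adj G x y ≡ true

-- Walks of G all of whose vertices satisfy P (connectivity inside the
-- subgraph induced by {x ∣ P x}).
data PPath {n} (G : Graph n) (P : Fin n → Set) : Fin n → Fin n → Set where
  here : ∀ {x} → P x → PPath G P x x
  step : ∀ {x y z} → P x → Adj G x y → PPath G P y z → PPath G P x z

-- u ∈ B forces w : w is white, and w is the only white neighbour of u
-- within the component of G - B containing w (together with B).
Forces : ∀ {n} → Graph n → Subset n → Fin n → Fin n → Set
Forces G B u w =
  u ∈ B × w ∉ B × Adj G u w ×
  (∀ w' → PPath G (λ x → x ∉ B) w w' → Adj G u w' → w' ≡ w)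

Step : ∀ {n} → Graph n → Subset n → Subset n → Set
Step G B B' = ∃[ u ] ∃[ w ] (Forces G B u w × B' ≡ B ∪ ⁅ w ⁆)

data Steps {n} (G : Graph n) : Subset n → Subset n → Set where
  done : ∀ {B} → Steps G B B
  more : ∀ {B B' B''} → Step G B B' → Steps G B' B'' → Steps G B B''

IsPZFSet : ∀ {n} → Graph n → Subset n → Set
IsPZFSet G S = Steps G S ⊤

IsZplus : ∀ {n} → Graph n → ℕ → Set
IsZplus {n} G k =
  (∃[ S ] (IsPZFSet G S × ∣ S ∣ ≡ k)) ×
  (∀ (S : Subset n) → IsPZFSet G S → k ≤ ∣ S ∣)

HasCycle : ∀ {n} → Graph n → (Fin n → Set) → Set
HasCycle {n} G P =
  ∃[ l ] Σ (Fin (suc (suc (suc l))) → Fin n) λ c → (Injective _≡_ _≡_ c ×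
    (∀ i → P (c i)) ×
    (∀ (i : Fin (suc (suc l))) → Adj G (c (inject₁ i)) (c (suc i))) ×
    Adj G (c (fromℕ (suc (suc l)))) (c zero))

InducesTree : ∀ {n} → Graph n → (Fin n → Set) → Set
InducesTree G P =
  (∃[ x ] P x) ×
  (∀ x y → P x → P y → PPath G P x y) ×
  ¬ HasCycle G P

IsTree : ∀ {n} → Graph n → Set
IsTree G = InducesTree G (λ _ → Unit)

TreeCover : ∀ {n} → Graph n → ℕ → Set
TreeCover {n} G k =
  Σ (Fin n → Fin k) λ c → (∀ (i : Fin k) → InducesTree G (λ x → c x ≡ i))

IsTreeCoverNumber : ∀ {n} → Graph n → ℕ → Set
IsTreeCoverNumber G k = TreeCover G k × (∀ k' → TreeCover G k' → k ≤ k')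

-- The sum lives on Fin (n + m):
-- the first n vertices are G, the remaining m are T minus t (t ↦ v).

private
  adjM : ∀ {k} → (Fin k → Fin k → Bool) → Maybe (Fin k) → Maybe (Fin k) → Bool
  adjM A (just a) (just b) = A a b
  adjM A _        _        = false

  symM : ∀ {k} (A : Fin k → Fin k → Bool) → (∀ a b → A a b ≡ A b a) →
         ∀ p q → adjM A p q ≡ adjM A q p
  symM A s (just a) (just b) = s a b
  symM A s (just a) nothing  = refl
  symM A s nothing  (just b) = refl
  symM A s nothing  nothing  = refl

  irrM : ∀ {k} (A : Fin k → Fin k → Bool) → (∀ a → A a a ≡ false) →
         ∀ p → adjM A p p ≡ false
  irrM A i (just a) = i a
  irrM A i nothing  = refl

module _ {n m : ℕ} (G : Graph n) (v : Fin n) (T : Graph (suc m)) (t : Fin (suc m)) where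

  toG : Fin (n + m) → Maybe (Fin n)
  toG x with splitAt n x
  ... | inj₁ a = just a
  ... | inj₂ _ = nothing

  toT : Fin (n + m) → Maybe (Fin (suc m))
  toT x with splitAt n x
  ... | inj₁ a with a ≟ v
  ...   | yes _ = just t
  ...   | no _  = nothing
  toT x | inj₂ b = just (punchIn t b)

  vsumAdj : Fin (n + m) → Fin (n + m) → Bool
  vsumAdj x y = adjM (adj G) (toG x) (toG y) ∨ adjM (adj T) (toT x) (toT y)

  vertexSum : Graph (n + m)
  vertexSum = record
    { adj    = vsumAdj
    ; sym    = λ x y → cong₂ _∨_ (symM (adj G) (sym G) (toG x) (toG y))
                                 (symM (adj T) (sym T) (toT x) (toT y))
    ; irrefl = λ x → cong₂ _∨_ (irrM (adj G) (irrefl G) (toG x))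
                               (irrM (adj T) (irrefl T) (toT x))
    }

module Submission where

-- Write H = G +ᵥ T.  Its vertices are the copy of G and the vertices R of
-- T other than t; v is a cut vertex of H separating G - v from R.
--
-- Colouring H by
--   "side" (G or R), every edge avoiding v is monochromatic, so a cycle of H
--   lies entirely in G or entirely in T (cut-vertex lemma); and a walk of H
--   projects onto a walk of G by collapsing T onto v.
-- * Tree cover number.  A tree cover of G extends to one of H with the same
--   number of trees (the tree through v absorbs T); conversely a tree cover of
--   H restricts to G, after dropping classes that become empty.
-- * Positive zero forcing.  A forcing process of G lifts to H and, once G is
--   black, finishes T leaf by leaf, since T is acyclic.  Conversely, forcing in
--   H is simulated in G from the G-part of the initial set, plus v if it
--   contained a vertex of R; this set is no larger.

open import Defs hiding (sym)
open import Data.Nat using (ℕ; zero; suc; _+_; _≤_; _<_; _≤′_; ≤′-refl; ≤′-step; z≤n; s≤s; _<?_)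
open import Data.Nat.Properties
  using (≤-refl; ≤-trans; ≤-antisym; ≤-total; n≤1+n; m≤m+n; m≤n⇒m≤1+n; ≤′⇒≤; ≤⇒≤′;
         <-≤-trans; <-irrefl; <⇒≤; ≮⇒≥; n≮0; +-suc; +-identityʳ; +-monoʳ-≤; ≤-reflexive; module ≤-Reasoning)
open import Data.Bool using (Bool; true; false)
open import Data.Bool.Properties using (∨-identityʳ) renaming (_≟_ to _≟ᵇ_)
open import Data.Fin using (Fin; zero; suc; inject₁; fromℕ; fromℕ<; toℕ; splitAt; punchIn; punchOut; _↑ˡ_; _↑ʳ_)
open import Data.Fin.Properties
  using (_≟_; any?; all?; ¬∀⟶∃¬; toℕ-fromℕ<; fromℕ<-toℕ; toℕ-inject₁; toℕ-fromℕ; toℕ<n; toℕ≤pred[n];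
         splitAt-↑ˡ; splitAt-↑ʳ; splitAt⁻¹-↑ˡ; splitAt⁻¹-↑ʳ; ↑ˡ-injective;
         punchIn-punchOut; punchOut-punchIn; punchOut-cong; punchInᵢ≢i; punchIn-injective)
open import Data.Fin.Subset using (Subset; _∈_; _∉_; _∪_; ⁅_⁆; ∣_∣; ⊤; ⊥; inside; outside)
open import Data.Fin.Subset.Properties
  using (⊆-antisym; x∈p∪q⁺; x∈p∪q⁻; x∈⁅x⁆; x∈⁅y⁆⇒x≡y; ∈⊤; ∉⊥; ∣⊥∣≡0; ∣⁅x⁆∣≡1; ∣p∣≤n;
         ∣p∣≡n⇒p≡⊤; p⊆q⇒∣p∣≤∣q∣; p⊂q⇒∣p∣<∣q∣; nonempty?)
  renaming (_∈?_ to _∈ˢ?_)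
open import Data.Vec using ([]; _∷_; _++_)
import Data.Vec as Vec
open import Data.Vec.Properties using (lookup-++ˡ; lookup-++ʳ; lookup⇒[]=; []=⇒lookup)
open import Data.List using (List; []; _∷_)
open import Data.List.Membership.Propositional using () renaming (_∈_ to _∈ˡ_)
import Data.List.Membership.DecPropositional as DecMembership
open import Data.List.Relation.Unary.Any using (here; there)
open import Data.List.Relation.Unary.All using ([]) renaming (lookup to lookupAll)
open import Data.List.Relation.Unary.All.Properties using (¬Any⇒All¬)
open import Data.List.Relation.Unary.Unique.Propositional using (Unique; []; _∷_)
open import Data.Maybe using (just; nothing)
open import Data.Product using (Σ; ∃-syntax; _×_; _,_; proj₁; proj₂)
open import Data.Sum using (_⊎_; inj₁; inj₂; [_,_]′)
open import Data.Unit using () renaming (⊤ to Unit; tt to unit)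
open import Data.Empty using (⊥-elim)
open import Relation.Nullary using (¬_; yes; no)
open import Relation.Binary.PropositionalEquality
  using (_≡_; _≢_; refl; sym; trans; cong; subst; subst₂; module ≡-Reasoning)
open import Function using (_∘_; id; const)
open import Function.Bundles using (_⇔_; mk⇔)
open import Function.Definitions using (Injective)

module _ {N : ℕ} (K : Graph N) where

  open DecMembership (_≟_ {N}) using (_∈?_)

  adjSym : ∀ {x y} → Adj K x y → Adj K y x
  adjSym {x} {y} xy = trans (Graph.sym K y x) xy

  walk-mono : ∀ {P Q : Fin N → Set} → (∀ {x} → P x → Q x) →
              ∀ {x y} → PPath K P x y → PPath K Q x y
  walk-mono P⊆Q (here px)      = here (P⊆Q px)
  walk-mono P⊆Q (step px xy r) = step (P⊆Q px) xy (walk-mono P⊆Q r)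

  walk-++ : ∀ {P x y z} → PPath K P x y → PPath K P y z → PPath K P x z
  walk-++ (here _)       q = q
  walk-++ (step px xy r) q = step px xy (walk-++ r q)

  module _ {P : Fin N → Set} where

    walk-head : ∀ {x y} → PPath K P x y → P x
    walk-head (here px)     = px
    walk-head (step px _ _) = px

    walk-reverse : ∀ {x y} → PPath K P x y → PPath K P y x
    walk-reverse (here px)      = here px
    walk-reverse (step px xy r) = walk-++ (walk-reverse r) (step (walk-head r) (adjSym xy) (here px))

    exitEdge : ∀ (X : Subset N) {x y} → PPath K P x y → x ∈ X → y ∉ X →
               ∃[ u ] ∃[ w ] (u ∈ X × w ∉ X × Adj K u w)
    exitEdge X (here _) x∈X x∉X = ⊥-elim (x∉X x∈X)
    exitEdge X (step {x} {y} _ xy r) x∈X z∉X with y ∈ˢ? X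
    ... | yes y∈X = exitEdge X r y∈X z∉X
    ... | no  y∉X = x , y , x∈X , y∉X , xy

    vertices : ∀ {x y} → PPath K P x y → List (Fin N)
    vertices (here {x} _)     = x ∷ []
    vertices (step {x} _ _ r) = x ∷ vertices r

    length : ∀ {x y} → PPath K P x y → ℕ
    length (here _)     = 0
    length (step _ _ r) = suc (length r)

    vertex : ∀ {x y} (p : PPath K P x y) → Fin (suc (length p)) → Fin N
    vertex {x} p            zero    = x
    vertex     (step _ _ r) (suc i) = vertex r i

    vertex-last : ∀ {x y} (p : PPath K P x y) → vertex p (fromℕ (length p)) ≡ y
    vertex-last (here _)     = refl
    vertex-last (step _ _ r) = vertex-last r

    vertex-adj : ∀ {x y} (p : PPath K P x y) (i : Fin (length p)) →
                 Adj K (vertex p (inject₁ i)) (vertex p (suc i))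
    vertex-adj (step _ xy _) zero    = xy
    vertex-adj (step _ _ r)  (suc i) = vertex-adj r i

    vertex-P : ∀ {x y} (p : PPath K P x y) i → P (vertex p i)
    vertex-P p            zero    = walk-head p
    vertex-P (step _ _ r) (suc i) = vertex-P r i

    vertex-∈ : ∀ {x y} (p : PPath K P x y) i → vertex p i ∈ˡ vertices p
    vertex-∈ (here _)     zero    = here refl
    vertex-∈ (step _ _ _) zero    = here refl
    vertex-∈ (step _ _ r) (suc i) = there (vertex-∈ r i)

    IsPath : ∀ {x y} → PPath K P x y → Set
    IsPath p = Unique (vertices p)

    vertex-injective : ∀ {x y} (p : PPath K P x y) → IsPath p →
                       ∀ {i j} → vertex p i ≡ vertex p j → i ≡ j
    vertex-injective p            _         {zero}  {zero}  _  = refl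
    vertex-injective (step _ _ r) (x∉r ∷ _) {zero}  {suc j} eq = ⊥-elim (lookupAll x∉r (vertex-∈ r j) eq)
    vertex-injective (step _ _ r) (x∉r ∷ _) {suc i} {zero}  eq = ⊥-elim (lookupAll x∉r (vertex-∈ r i) (sym eq))
    vertex-injective (step _ _ r) (_ ∷ pr)  {suc i} {suc j} eq = cong suc (vertex-injective r pr eq)

    suffix : ∀ {x y z} (p : PPath K P x y) → z ∈ˡ vertices p → PPath K P z y
    suffix (here px)       (here refl) = here px
    suffix (step px xy r)  (here refl) = step px xy r
    suffix (step _ _ r)    (there z∈r) = suffix r z∈r

    suffix-isPath : ∀ {x y z} (p : PPath K P x y) (z∈p : z ∈ˡ vertices p) →
                    IsPath p → IsPath (suffix p z∈p)
    suffix-isPath (here _)     (here refl) u        = u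
    suffix-isPath (step _ _ _) (here refl) u        = u
    suffix-isPath (step _ _ r) (there z∈r) (_ ∷ u) = suffix-isPath r z∈r u

    loopErase : ∀ {x y} → PPath K P x y → Σ (PPath K P x y) IsPath
    loopErase (here px) = here px , [] ∷ []
    loopErase (step {x} px xy r) with loopErase r
    ... | r' , r'-path with x ∈? vertices r'
    ...   | yes x∈r' = suffix r' x∈r' , suffix-isPath r' x∈r' r'-path
    ...   | no  x∉r' = step px xy r' , ¬Any⇒All¬ (vertices r') x∉r' ∷ r'-path

  cycleThrough : ∀ {P a a' s} → PPath K P a a' → a ≢ a' → ¬ P s →
                 Adj K s a → Adj K s a' → HasCycle K (λ x → P x ⊎ x ≡ s)
  cycleThrough {P} {s = s} p a≢a' s∉P sa sa' with loopErase {P} p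
  ... | here _ , _ = ⊥-elim (a≢a' refl)
  ... | q@(step _ _ r) , q-path = length r , cyc , cyc-inj , cyc-P , cyc-adj , cyc-close
    where
    cyc : Fin (suc (suc (suc (length r)))) → Fin N
    cyc zero    = s
    cyc (suc i) = vertex q i

    cyc-inj : ∀ {i j} → cyc i ≡ cyc j → i ≡ j
    cyc-inj {zero}  {zero}  _  = refl
    cyc-inj {zero}  {suc j} eq = ⊥-elim (s∉P (subst P (sym eq) (vertex-P q j)))
    cyc-inj {suc i} {zero}  eq = ⊥-elim (s∉P (subst P eq (vertex-P q i)))
    cyc-inj {suc i} {suc j} eq = cong suc (vertex-injective q q-path eq)

    cyc-P : ∀ i → P (cyc i) ⊎ cyc i ≡ s
    cyc-P zero    = inj₂ refl
    cyc-P (suc i) = inj₁ (vertex-P q i)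

    cyc-adj : ∀ i → Adj K (cyc (inject₁ i)) (cyc (suc i))
    cyc-adj zero    = sa
    cyc-adj (suc i) = vertex-adj q i

    cyc-close : Adj K (cyc (fromℕ (suc (suc (length r))))) s
    cyc-close = subst (λ z → Adj K z s) (sym (vertex-last q)) (adjSym sa')


module _ {N₁ N₂ : ℕ} {K₁ : Graph N₁} {K₂ : Graph N₂} {P : Fin N₁ → Set} {Q : Fin N₂ → Set}
         (f : Fin N₁ → Fin N₂) (f-P : ∀ {x} → P x → Q (f x))
         (f-adj : ∀ {x y} → P x → P y → Adj K₁ x y → Adj K₂ (f x) (f y)) where

  walk-map : ∀ {x y} → PPath K₁ P x y → PPath K₂ Q (f x) (f y)
  walk-map (here px)      = here (f-P px)
  walk-map (step px xy r) = step (f-P px) (f-adj px (walk-head K₁ r) xy) (walk-map r)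

  cycle-map : (∀ {x y} → P x → P y → f x ≡ f y → x ≡ y) → HasCycle K₁ P → HasCycle K₂ Q
  cycle-map f-inj (l , c , c-inj , c-P , c-adj , c-close) =
    l , f ∘ c , (λ e → c-inj (f-inj (c-P _) (c-P _) e)) , (λ i → f-P (c-P i)) ,
    (λ i → f-adj (c-P _) (c-P _) (c-adj i)) , f-adj (c-P _) (c-P zero) c-close

cycle-mono : ∀ {N} {K : Graph N} {P Q : Fin N → Set} → (∀ {x} → P x → Q x) → HasCycle K P → HasCycle K Q
cycle-mono {K = K} {P} {Q} P⊆Q = cycle-map {K₁ = K} {K₂ = K} {P} {Q} id P⊆Q (λ _ _ xy → xy) (λ _ _ e → e)

-- Let σ colour the vertices of K so that every edge avoiding the vertex z
-- joins equally coloured vertices (z is a cut vertex separating the colours).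
-- Then all vertices of a cycle, except z itself, have the same colour:
-- the cycle minus z is a path, and colour can only change at z.
module CutVertex {N : ℕ} (K : Graph N) (σ : Fin N → Bool) (z : Fin N)
  (sides : ∀ {x y} → Adj K x y → x ≢ z → y ≢ z → σ x ≡ σ y) where

  module _ {l : ℕ} (c : Fin (suc (suc (suc l))) → Fin N) (c-inj : Injective _≡_ _≡_ c)
           (c-adj : ∀ (i : Fin (suc (suc l))) → Adj K (c (inject₁ i)) (c (suc i)))
           (c-close : Adj K (c (fromℕ (suc (suc l)))) (c zero)) where

    M : ℕ
    M = suc (suc l)

    seq : ℕ → Fin N
    seq k with k <? suc M
    ... | yes k<sM = c (fromℕ< k<sM)
    ... | no  _    = c zero

    seq-fromℕ< : ∀ {k} (k<sM : k < suc M) → seq k ≡ c (fromℕ< k<sM)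
    seq-fromℕ< {k} k<sM with k <? suc M
    ... | yes _    = refl
    ... | no  k≮sM = ⊥-elim (k≮sM k<sM)

    seq-toℕ : ∀ i → seq (toℕ i) ≡ c i
    seq-toℕ i = trans (seq-fromℕ< (toℕ<n i)) (cong c (fromℕ<-toℕ i _))

    seq-step : ∀ k → suc k ≤ M → Adj K (seq k) (seq (suc k))
    seq-step k k<M = subst₂ (Adj K) at-k at-sk (c-adj i)
      where
      i : Fin M
      i = fromℕ< k<M
      at-k : c (inject₁ i) ≡ seq k
      at-k = trans (sym (seq-toℕ (inject₁ i))) (cong seq (trans (toℕ-inject₁ i) (toℕ-fromℕ< k<M)))
      at-sk : c (suc i) ≡ seq (suc k)
      at-sk = trans (sym (seq-toℕ (suc i))) (cong (seq ∘ suc) (toℕ-fromℕ< k<M))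

    seq-close : Adj K (seq M) (seq 0)
    seq-close = subst₂ (Adj K) (trans (sym (seq-toℕ (fromℕ M))) (cong seq (toℕ-fromℕ M)))
                               (sym (seq-toℕ zero)) c-close

    Free : ℕ → ℕ → Set
    Free a b = ∀ k → a ≤ k → k ≤ b → seq k ≢ z

    arc : ∀ {a b} → a ≤′ b → b ≤ M → Free a b → σ (seq a) ≡ σ (seq b)
    arc ≤′-refl _ _ = refl
    arc {a} (≤′-step {b} a≤′b) sb≤M free =
      trans (arc a≤′b b≤M (λ k a≤k k≤b → free k a≤k (≤-trans k≤b (n≤1+n b))))
            (sides (seq-step b sb≤M) (free b a≤b (n≤1+n b)) (free (suc b) (≤-trans a≤b (n≤1+n b)) ≤-refl))
      where
      a≤b : a ≤ b
      a≤b = ≤′⇒≤ a≤′b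
      b≤M : b ≤ M
      b≤M = ≤-trans (n≤1+n b) sb≤M

    module OnlyAt (p : ℕ) (only : ∀ k → k ≤ M → seq k ≡ z → k ≡ p) where
      open ≡-Reasoning

      free-beside : ∀ {a b} → b ≤ M → seq a ≢ z → seq b ≢ z → p ≤ a ⊎ b ≤ p → Free a b
      free-beside b≤M za zb (inj₁ p≤a) k a≤k k≤b zk with only k (≤-trans k≤b b≤M) zk
      ... | refl = za (subst (λ i → seq i ≡ z) (≤-antisym p≤a a≤k) zk)
      free-beside b≤M za zb (inj₂ b≤p) k a≤k k≤b zk with only k (≤-trans k≤b b≤M) zk
      ... | refl = zb (subst (λ i → seq i ≡ z) (≤-antisym k≤b b≤p) zk)

      sameColour : ∀ {a b} → a ≤ b → b ≤ M → seq a ≢ z → seq b ≢ z → σ (seq a) ≡ σ (seq b)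
      sameColour {a} {b} a≤b b≤M za zb with a <? p | p <? b
      ... | yes a<p | yes p<b =
        begin
          σ (seq a) ≡⟨ sym (arc (≤⇒≤′ z≤n) a≤M (free-beside a≤M z0 za (inj₂ (<⇒≤ a<p)))) ⟩
          σ (seq 0) ≡⟨ sym (sides seq-close zM z0) ⟩
          σ (seq M) ≡⟨ sym (arc (≤⇒≤′ b≤M) ≤-refl (free-beside ≤-refl zb zM (inj₁ (<⇒≤ p<b)))) ⟩
          σ (seq b) ∎
        where
        a≤M : a ≤ M
        a≤M = ≤-trans a≤b b≤M
        z0 : seq 0 ≢ z
        z0 e = n≮0 (subst (a <_) (sym (only 0 z≤n e)) a<p)
        zM : seq M ≢ z
        zM e = <-irrefl (sym (only M ≤-refl e)) (<-≤-trans p<b b≤M)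
      ... | no a≮p | _       = arc (≤⇒≤′ a≤b) b≤M (free-beside b≤M za zb (inj₁ (≮⇒≥ a≮p)))
      ... | yes _  | no p≮b  = arc (≤⇒≤′ a≤b) b≤M (free-beside b≤M za zb (inj₂ (≮⇒≥ p≮b)))

    -- injectivity of c: z occurs at most once on the cycle
    zPosition : ∃[ p ] (∀ k → k ≤ M → seq k ≡ z → k ≡ p)
    zPosition with any? (λ i → c i ≟ z)
    ... | yes (q , cq) = toℕ q , λ k k≤M zk →
            trans (sym (toℕ-fromℕ< (s≤s k≤M)))
                  (cong toℕ (c-inj (trans (sym (seq-fromℕ< (s≤s k≤M))) (trans zk (sym cq)))))
    ... | no  z∉c      = suc M , λ k k≤M zk → ⊥-elim (z∉c (fromℕ< (s≤s k≤M) , trans (sym (seq-fromℕ< (s≤s k≤M))) zk))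

    avoid : ∀ i → c i ≢ z → seq (toℕ i) ≢ z
    avoid i zi e = zi (trans (sym (seq-toℕ i)) e)

    cycle-oneColour : ∀ i j → c i ≢ z → c j ≢ z → σ (c i) ≡ σ (c j)
    cycle-oneColour i j zi zj with zPosition | ≤-total (toℕ i) (toℕ j)
    ... | p , only | inj₁ i≤j = subst₂ (λ x y → σ x ≡ σ y) (seq-toℕ i) (seq-toℕ j)
                                  (OnlyAt.sameColour p only i≤j (toℕ≤pred[n] j) (avoid i zi) (avoid j zj))
    ... | p , only | inj₂ j≤i = subst₂ (λ x y → σ x ≡ σ y) (seq-toℕ i) (seq-toℕ j)
                                  (sym (OnlyAt.sameColour p only j≤i (toℕ≤pred[n] i) (avoid j zj) (avoid i zi)))

ConnectedAcyclic : ∀ {N} → Graph N → (Fin N → Set) → Set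
ConnectedAcyclic K P = (∀ x y → P x → P y → PPath K P x y) × ¬ HasCycle K P

WeakTreeCover : ∀ {N} → Graph N → ℕ → Set
WeakTreeCover {N} K k = Σ (Fin N → Fin k) λ c → ∀ i → ConnectedAcyclic K (λ z → c z ≡ i)

dropClass : ∀ {N} {K : Graph N} {k} (c : Fin N → Fin (suc k)) → (∀ i → ConnectedAcyclic K (λ z → c z ≡ i)) →
            (i : Fin (suc k)) → (∀ x → i ≢ c x) → WeakTreeCover K k
dropClass {N} {K} {k} c classes i i∉c = c' , λ j →
    (λ x y x∈j y∈j → walk-mono K from (proj₁ (classes (punchIn i j)) x y (to x∈j) (to y∈j))) ,
    (λ cyc → proj₂ (classes (punchIn i j)) (cycle-mono {K = K} (λ {x} → to {x}) cyc))
  where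
  c' : Fin N → Fin k
  c' x = punchOut (i∉c x)
  to : ∀ {x j} → c' x ≡ j → c x ≡ punchIn i j
  to {x} e = trans (sym (punchIn-punchOut (i∉c x))) (cong (punchIn i) e)
  from : ∀ {x j} → c x ≡ punchIn i j → c' x ≡ j
  from {x} e = punchIn-injective i _ _ (trans (punchIn-punchOut (i∉c x)) e)

dropEmptyClasses : ∀ {N} (K : Graph N) k → WeakTreeCover K k → ∃[ k' ] (k' ≤ k × TreeCover K k')
dropEmptyClasses K k (c , classes) with all? (λ i → any? (λ x → c x ≟ i))
... | yes nonempty = k , ≤-refl , c , λ i → nonempty i , classes i
dropEmptyClasses K zero    (c , classes) | no someEmpty = ⊥-elim (someEmpty (λ ()))
dropEmptyClasses K (suc k) (c , classes) | no someEmpty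
  with ¬∀⟶∃¬ (suc k) _ (λ i → any? (λ x → c x ≟ i)) someEmpty
... | i , i-empty with dropEmptyClasses K k (dropClass c classes i (λ x e → i-empty (x , sym e)))
...   | k' , k'≤k , cover = k' , m≤n⇒m≤1+n k'≤k , cover

steps-++ : ∀ {N} {K : Graph N} {A B C} → Steps K A B → Steps K B C → Steps K A C
steps-++ done       q = q
steps-++ (more s r) q = more s (steps-++ r q)

∈-∪⁅⁆⁻ : ∀ {k} (p : Subset k) {x} w → x ∈ p ∪ ⁅ w ⁆ → x ∈ p ⊎ x ≡ w
∈-∪⁅⁆⁻ p w x∈ with x∈p∪q⁻ p ⁅ w ⁆ x∈
... | inj₁ x∈p = inj₁ x∈p
... | inj₂ x∈w = inj₂ (x∈⁅y⁆⇒x≡y w x∈w)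

∈-∪ˡ : ∀ {k} {p q : Subset k} {x} → x ∈ p → x ∈ p ∪ q
∈-∪ˡ x∈p = x∈p∪q⁺ (inj₁ x∈p)

∈-∪⁅⁆ : ∀ {k} {p : Subset k} w → w ∈ p ∪ ⁅ w ⁆
∈-∪⁅⁆ w = x∈p∪q⁺ (inj₂ (x∈⁅x⁆ w))

∣p∪q∣≤∣p∣+∣q∣ : ∀ {k} (p q : Subset k) → ∣ p ∪ q ∣ ≤ ∣ p ∣ + ∣ q ∣
∣p∪q∣≤∣p∣+∣q∣ []            []            = z≤n
∣p∪q∣≤∣p∣+∣q∣ (inside  ∷ p) (inside  ∷ q) = s≤s (≤-trans (∣p∪q∣≤∣p∣+∣q∣ p q) (+-monoʳ-≤ ∣ p ∣ (n≤1+n ∣ q ∣)))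
∣p∪q∣≤∣p∣+∣q∣ (inside  ∷ p) (outside ∷ q) = s≤s (∣p∪q∣≤∣p∣+∣q∣ p q)
∣p∪q∣≤∣p∣+∣q∣ (outside ∷ p) (inside  ∷ q) = ≤-trans (s≤s (∣p∪q∣≤∣p∣+∣q∣ p q)) (≤-reflexive (sym (+-suc ∣ p ∣ ∣ q ∣)))
∣p∪q∣≤∣p∣+∣q∣ (outside ∷ p) (outside ∷ q) = ∣p∪q∣≤∣p∣+∣q∣ p q

∣p++q∣ : ∀ {a b} (p : Subset a) (q : Subset b) → ∣ p ++ q ∣ ≡ ∣ p ∣ + ∣ q ∣
∣p++q∣ []            q = refl
∣p++q∣ (inside  ∷ p) q = cong suc (∣p++q∣ p q)
∣p++q∣ (outside ∷ p) q = ∣p++q∣ p q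

module _ {a b : ℕ} (p : Subset a) (q : Subset b) where

  ∈-++ˡ : ∀ {i} → i ∈ p → (i ↑ˡ b) ∈ p ++ q
  ∈-++ˡ {i} i∈p = lookup⇒[]= _ _ (trans (lookup-++ˡ p q i) ([]=⇒lookup i∈p))

  ∈-++ˡ⁻ : ∀ {i} → (i ↑ˡ b) ∈ p ++ q → i ∈ p
  ∈-++ˡ⁻ {i} i∈pq = lookup⇒[]= _ _ (trans (sym (lookup-++ˡ p q i)) ([]=⇒lookup i∈pq))

  ∈-++ʳ⁻ : ∀ {i} → (a ↑ʳ i) ∈ p ++ q → i ∈ q
  ∈-++ʳ⁻ {i} i∈pq = lookup⇒[]= _ _ (trans (sym (lookup-++ʳ p q i)) ([]=⇒lookup i∈pq))

-- The vertex sum H = G +ᵥ T.  Its vertices are ιG a (a a vertex of G) and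
-- ιR b (b a vertex of R = T - t, standing for punchIn t b in T).
module VertexSum {n m : ℕ} (G : Graph n) (v : Fin n) (T : Graph (suc m)) (t : Fin (suc m)) where

  H : Graph (n + m)
  H = vertexSum G v T t

  ιG : Fin n → Fin (n + m)
  ιG a = a ↑ˡ m

  ιR : Fin m → Fin (n + m)
  ιR b = n ↑ʳ b

  ιG-injective : ∀ {a a'} → ιG a ≡ ιG a' → a ≡ a'
  ιG-injective = ↑ˡ-injective m _ _

  View : Fin (n + m) → Set
  View x = (∃[ a ] x ≡ ιG a) ⊎ (∃[ b ] x ≡ ιR b)

  view : ∀ x → View x
  view x with splitAt n x in eq
  ... | inj₁ a = inj₁ (a , sym (splitAt⁻¹-↑ˡ eq))
  ... | inj₂ b = inj₂ (b , sym (splitAt⁻¹-↑ʳ eq))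

  onG : Fin (n + m) → Bool
  onG x = [ const true , const false ]′ (splitAt n x)

  πG : Fin (n + m) → Fin n
  πG x = [ id , const v ]′ (splitAt n x)

  πT : Fin (n + m) → Fin (suc m)
  πT x = [ const t , punchIn t ]′ (splitAt n x)

  onG-ιG : ∀ a → onG (ιG a) ≡ true
  onG-ιG a = cong [ const true , const false ]′ (splitAt-↑ˡ n a m)

  onG-ιR : ∀ b → onG (ιR b) ≡ false
  onG-ιR b = cong [ const true , const false ]′ (splitAt-↑ʳ n m b)

  πG-ιG : ∀ a → πG (ιG a) ≡ a
  πG-ιG a = cong [ id , const v ]′ (splitAt-↑ˡ n a m)

  πG-ιR : ∀ b → πG (ιR b) ≡ v
  πG-ιR b = cong [ id , const v ]′ (splitAt-↑ʳ n m b)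

  πT-ιG : ∀ a → πT (ιG a) ≡ t
  πT-ιG a = cong [ const t , punchIn t ]′ (splitAt-↑ˡ n a m)

  πT-ιR : ∀ b → πT (ιR b) ≡ punchIn t b
  πT-ιR b = cong [ const t , punchIn t ]′ (splitAt-↑ʳ n m b)

  ιG≢ιR : ∀ {a b} → ιG a ≢ ιR b
  ιG≢ιR {a} {b} e with trans (sym (onG-ιG a)) (trans (cong onG e) (onG-ιR b))
  ... | ()

  toG-ιG : ∀ a → toG G v T t (ιG a) ≡ just a
  toG-ιG a with splitAt n (ιG a) | splitAt-↑ˡ n a m
  ... | .(inj₁ a) | refl = refl

  toG-ιR : ∀ b → toG G v T t (ιR b) ≡ nothing
  toG-ιR b with splitAt n (ιR b) | splitAt-↑ʳ n m b
  ... | .(inj₂ b) | refl = refl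

  toT-ιG-v : toT G v T t (ιG v) ≡ just t
  toT-ιG-v with splitAt n (ιG v) | splitAt-↑ˡ n v m
  ... | .(inj₁ v) | refl with v ≟ v
  ...   | yes _   = refl
  ...   | no  v≢v = ⊥-elim (v≢v refl)

  toT-ιG : ∀ a → a ≢ v → toT G v T t (ιG a) ≡ nothing
  toT-ιG a a≢v with splitAt n (ιG a) | splitAt-↑ˡ n a m
  ... | .(inj₁ a) | refl with a ≟ v
  ...   | yes a≡v = ⊥-elim (a≢v a≡v)
  ...   | no  _   = refl

  toT-ιR : ∀ b → toT G v T t (ιR b) ≡ just (punchIn t b)
  toT-ιR b with splitAt n (ιR b) | splitAt-↑ʳ n m b
  ... | .(inj₂ b) | refl = refl

  adj-GG : ∀ a a' → adj H (ιG a) (ιG a') ≡ adj G a a'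
  adj-GG a a' with a ≟ v | a' ≟ v
  ... | yes refl | yes refl rewrite toG-ιG v | toT-ιG-v | irrefl T t = ∨-identityʳ _
  ... | yes refl | no a'≢v rewrite toG-ιG v | toG-ιG a' | toT-ιG-v | toT-ιG a' a'≢v = ∨-identityʳ _
  ... | no a≢v   | yes refl rewrite toG-ιG a | toG-ιG v | toT-ιG-v | toT-ιG a a≢v = ∨-identityʳ _
  ... | no a≢v   | no a'≢v rewrite toG-ιG a | toG-ιG a' | toT-ιG a a≢v = ∨-identityʳ _

  adj-vR : ∀ b → adj H (ιG v) (ιR b) ≡ adj T t (punchIn t b)
  adj-vR b rewrite toG-ιG v | toG-ιR b | toT-ιG-v | toT-ιR b = refl

  adj-GR : ∀ a b → a ≢ v → adj H (ιG a) (ιR b) ≡ false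
  adj-GR a b a≢v rewrite toG-ιG a | toG-ιR b | toT-ιG a a≢v = refl

  adj-RR : ∀ b b' → adj H (ιR b) (ιR b') ≡ adj T (punchIn t b) (punchIn t b')
  adj-RR b b' rewrite toG-ιR b | toT-ιR b | toT-ιR b' = refl

  adj-GR⇒v : ∀ {a b} → Adj H (ιG a) (ιR b) → a ≡ v
  adj-GR⇒v {a} {b} e with a ≟ v
  ... | yes a≡v = a≡v
  ... | no  a≢v with trans (sym e) (adj-GR a b a≢v)
  ...   | ()

  adj-RG⇒v : ∀ {a b} → Adj H (ιR b) (ιG a) → a ≡ v
  adj-RG⇒v e = adj-GR⇒v (adjSym H e)

  adj-sameSide : ∀ {x y} → Adj H x y → x ≢ ιG v → y ≢ ιG v → onG x ≡ onG y
  adj-sameSide {x} {y} e x≢v y≢v with view x | view y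
  ... | inj₁ (a , refl) | inj₁ (a' , refl) = trans (onG-ιG a) (sym (onG-ιG a'))
  ... | inj₁ (a , refl) | inj₂ (b , refl)  = ⊥-elim (x≢v (cong ιG (adj-GR⇒v e)))
  ... | inj₂ (b , refl) | inj₁ (a , refl)  = ⊥-elim (y≢v (cong ιG (adj-RG⇒v e)))
  ... | inj₂ (b , refl) | inj₂ (b' , refl) = trans (onG-ιR b) (sym (onG-ιR b'))

  ιG-πG : ∀ {x} → onG x ≡ true → x ≡ ιG (πG x)
  ιG-πG {x} x∈G with view x
  ... | inj₁ (a , refl) = cong ιG (sym (πG-ιG a))
  ... | inj₂ (b , refl) with trans (sym x∈G) (onG-ιR b)
  ...   | ()

  ιT : Fin (suc m) → Fin (n + m)
  ιT y with t ≟ y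
  ... | yes _   = ιG v
  ... | no  t≢y = ιR (punchOut t≢y)

  ιT-t : ιT t ≡ ιG v
  ιT-t with t ≟ t
  ... | yes _   = refl
  ... | no  t≢t = ⊥-elim (t≢t refl)

  ιT-punchIn : ∀ b → ιT (punchIn t b) ≡ ιR b
  ιT-punchIn b with t ≟ punchIn t b
  ... | yes t≡ = ⊥-elim (punchInᵢ≢i t b (sym t≡))
  ... | no  t≢ = cong ιR (trans (punchOut-cong t refl) (punchOut-punchIn t))

  viewT : ∀ y → y ≡ t ⊎ ∃[ b ] y ≡ punchIn t b
  viewT y with t ≟ y
  ... | yes t≡y = inj₁ (sym t≡y)
  ... | no  t≢y = inj₂ (punchOut t≢y , sym (punchIn-punchOut t≢y))

  adj-ιT : ∀ y y' → adj H (ιT y) (ιT y') ≡ adj T y y'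
  adj-ιT y y' with viewT y | viewT y'
  ... | inj₁ refl       | inj₁ refl rewrite ιT-t = trans (adj-GG v v) (trans (irrefl G v) (sym (irrefl T t)))
  ... | inj₁ refl       | inj₂ (b , refl) rewrite ιT-t | ιT-punchIn b = adj-vR b
  ... | inj₂ (b , refl) | inj₁ refl rewrite ιT-t | ιT-punchIn b =
        trans (Graph.sym H (ιR b) (ιG v)) (trans (adj-vR b) (Graph.sym T t (punchIn t b)))
  ... | inj₂ (b , refl) | inj₂ (b' , refl) rewrite ιT-punchIn b | ιT-punchIn b' = adj-RR b b'

  InT : Fin (n + m) → Set
  InT x = onG x ≡ false ⊎ x ≡ ιG v

  InT-view : ∀ {x} → InT x → x ≡ ιG v ⊎ ∃[ b ] x ≡ ιR b
  InT-view (inj₂ x≡v) = inj₁ x≡v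
  InT-view {x} (inj₁ x∉G) with view x
  ... | inj₂ r       = inj₂ r
  ... | inj₁ (a , refl) with trans (sym (onG-ιG a)) x∉G
  ...   | ()

  ιT-InT : ∀ y → InT (ιT y)
  ιT-InT y with viewT y
  ... | inj₁ refl       rewrite ιT-t = inj₂ refl
  ... | inj₂ (b , refl) rewrite ιT-punchIn b = inj₁ (onG-ιR b)

  ιT-πT : ∀ {x} → InT x → x ≡ ιT (πT x)
  ιT-πT x∈T with InT-view x∈T
  ... | inj₁ refl       rewrite πT-ιG v = sym ιT-t
  ... | inj₂ (b , refl) rewrite πT-ιR b = sym (ιT-punchIn b)

  πG-InT : ∀ {x} → InT x → πG x ≡ v
  πG-InT x∈T with InT-view x∈T
  ... | inj₁ refl       = πG-ιG v
  ... | inj₂ (b , refl) = πG-ιR b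

  πG-adj : ∀ {x y} → Adj H x y → πG x ≡ πG y ⊎ (x ≡ ιG (πG x) × Adj G (πG x) (πG y))
  πG-adj {x} {y} e with view x | view y
  ... | inj₁ (a , refl) | inj₁ (a' , refl) =
        inj₂ (cong ιG (sym (πG-ιG a)) , subst₂ (Adj G) (sym (πG-ιG a)) (sym (πG-ιG a')) (trans (sym (adj-GG a a')) e))
  ... | inj₁ (a , refl) | inj₂ (b , refl)  = inj₁ (trans (πG-ιG a) (trans (adj-GR⇒v e) (sym (πG-ιR b))))
  ... | inj₂ (b , refl) | inj₁ (a , refl)  = inj₁ (trans (πG-ιR b) (trans (sym (adj-RG⇒v e)) (sym (πG-ιG a))))
  ... | inj₂ (b , refl) | inj₂ (b' , refl) = inj₁ (trans (πG-ιR b) (sym (πG-ιR b')))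

  walk-fromG : ∀ {P : Fin (n + m) → Set} {a a'} → PPath G (P ∘ ιG) a a' → PPath H P (ιG a) (ιG a')
  walk-fromG {P} = walk-map {K₁ = G} {K₂ = H} {P ∘ ιG} {P} ιG id (λ {a} {a'} _ _ e → trans (adj-GG a a') e)

  walk-fromT : ∀ {y y'} → PPath T (const Unit) y y' → PPath H InT (ιT y) (ιT y')
  walk-fromT = walk-map {K₁ = T} {K₂ = H} {const Unit} {InT} ιT (λ {y} _ → ιT-InT y) (λ {y} {y'} _ _ e → trans (adj-ιT y y') e)

  walk-toG : ∀ {P : Fin (n + m) → Set} {x z} → PPath H P x z → onG z ≡ true →
             PPath G (P ∘ ιG) (πG x) (πG z)
  walk-toG {P} (here px) z∈G = here (subst P (ιG-πG z∈G) px)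
  walk-toG {P} (step px xy r) z∈G with πG-adj xy
  ... | inj₁ same          = subst (λ a → PPath G (P ∘ ιG) a _) (sym same) (walk-toG r z∈G)
  ... | inj₂ (x≡ , xy∈G) = step (subst P x≡ px) xy∈G (walk-toG r z∈G)

  cycle-fromG : ∀ {Q : Fin (n + m) → Set} → HasCycle G (Q ∘ ιG) → HasCycle H Q
  cycle-fromG {Q} = cycle-map {K₁ = G} {K₂ = H} {Q ∘ ιG} {Q} ιG id (λ {a} {a'} _ _ e → trans (adj-GG a a') e) (λ _ _ → ιG-injective)

  cycle-toG : ∀ {Q : Fin (n + m) → Set} → (∀ {x} → Q x → onG x ≡ true) → HasCycle H Q → HasCycle G (Q ∘ ιG)
  cycle-toG {Q} Q⊆G = cycle-map {K₁ = H} {K₂ = G} {Q} {Q ∘ ιG} πG (λ qx → subst Q (ιG-πG (Q⊆G qx)) qx)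
    (λ {x} {y} qx qy e → trans (sym (adj-GG (πG x) (πG y))) (subst₂ (Adj H) (ιG-πG (Q⊆G qx)) (ιG-πG (Q⊆G qy)) e))
    (λ qx qy e → trans (ιG-πG (Q⊆G qx)) (trans (cong ιG e) (sym (ιG-πG (Q⊆G qy)))))

  cycle-toT : HasCycle H InT → HasCycle T (const Unit)
  cycle-toT = cycle-map {K₁ = H} {K₂ = T} {InT} {const Unit} πT (const unit)
    (λ {x} {y} x∈T y∈T e → trans (sym (adj-ιT (πT x) (πT y))) (subst₂ (Adj H) (ιT-πT x∈T) (ιT-πT y∈T) e))
    (λ x∈T y∈T e → trans (ιT-πT x∈T) (trans (cong ιT e) (sym (ιT-πT y∈T))))

  -- by the cut-vertex lemma every cycle of H lies in G or in T
  cycle-split : ∀ {Q : Fin (n + m) → Set} → HasCycle H Q → HasCycle G (Q ∘ ιG) ⊎ HasCycle T (const Unit)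
  cycle-split {Q} (l , c , c-inj , c-Q , c-adj , c-close) with any? (λ j → onG (c j) ≟ᵇ false)
  ... | no  noneInR = inj₁ (cycle-mono {K = G} {λ a → Q (ιG a) × onG (ιG a) ≡ true} proj₁
                             (cycle-toG {λ x → Q x × onG x ≡ true} proj₂ (l , c , c-inj , (λ i → c-Q i , onG-c i) , c-adj , c-close)))
    where
    onG-c : ∀ i → onG (c i) ≡ true
    onG-c i with onG (c i) in eq
    ... | true  = refl
    ... | false = ⊥-elim (noneInR (i , eq))
  ... | yes (j , j∈R) = inj₂ (cycle-toT (l , c , c-inj , InT-c , c-adj , c-close))
    where
    open CutVertex H onG (ιG v) adj-sameSide using (cycle-oneColour)
    j≢v : c j ≢ ιG v
    j≢v j≡v with trans (sym j∈R) (trans (cong onG j≡v) (onG-ιG v))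
    ... | ()
    InT-c : ∀ i → InT (c i)
    InT-c i with onG (c i) in eq | c i ≟ ιG v
    ... | false | _       = inj₁ refl
    ... | true  | yes i≡v = inj₂ i≡v
    ... | true  | no  i≢v with trans (sym eq) (trans (cycle-oneColour c c-inj c-adj c-close i j i≢v j≢v) j∈R)
    ...   | ()

  -- Walks collapse to G and cycles of G are cycles of
  -- H, but a class may lose all its vertices, so only a weak cover results.
  coverToG : ∀ {k} → TreeCover H k → WeakTreeCover G k
  coverToG (c , trees) = c ∘ ιG , λ i →
      (λ a a' a∈i a'∈i → subst₂ (PPath G (λ z → c (ιG z) ≡ i)) (πG-ιG a) (πG-ιG a')
                           (walk-toG (proj₁ (proj₂ (trees i)) _ _ a∈i a'∈i) (onG-ιG a'))) ,
      (λ cyc → proj₂ (proj₂ (trees i)) (cycle-fromG {λ z → c z ≡ i} cyc))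

  liftSet : Subset n → Subset (n + m)
  liftSet S = S ++ ⊥

  ∣liftSet∣ : ∀ S → ∣ liftSet S ∣ ≡ ∣ S ∣
  ∣liftSet∣ S = trans (∣p++q∣ S ⊥) (trans (cong (∣ S ∣ +_) (∣⊥∣≡0 m)) (+-identityʳ _))

  liftSet-∪ : ∀ B w → liftSet (B ∪ ⁅ w ⁆) ≡ liftSet B ∪ ⁅ ιG w ⁆
  liftSet-∪ B w = ⊆-antisym ⊆ ⊇
    where
    ⊆ : ∀ {x} → x ∈ liftSet (B ∪ ⁅ w ⁆) → x ∈ liftSet B ∪ ⁅ ιG w ⁆
    ⊆ {x} x∈ with view x
    ... | inj₂ (b , refl) = ⊥-elim (∉⊥ (∈-++ʳ⁻ (B ∪ ⁅ w ⁆) ⊥ x∈))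
    ... | inj₁ (a , refl) with ∈-∪⁅⁆⁻ B w (∈-++ˡ⁻ (B ∪ ⁅ w ⁆) ⊥ x∈)
    ...   | inj₁ a∈B = ∈-∪ˡ (∈-++ˡ B ⊥ a∈B)
    ...   | inj₂ refl = ∈-∪⁅⁆ (ιG a)
    ⊇ : ∀ {x} → x ∈ liftSet B ∪ ⁅ ιG w ⁆ → x ∈ liftSet (B ∪ ⁅ w ⁆)
    ⊇ {x} x∈ with ∈-∪⁅⁆⁻ (liftSet B) (ιG w) x∈
    ... | inj₂ refl = ∈-++ˡ (B ∪ ⁅ w ⁆) ⊥ (∈-∪⁅⁆ w)
    ... | inj₁ x∈B with view x
    ...   | inj₂ (b , refl) = ⊥-elim (∉⊥ (∈-++ʳ⁻ B ⊥ x∈B))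
    ...   | inj₁ (a , refl) = ∈-++ˡ (B ∪ ⁅ w ⁆) ⊥ (∈-∪ˡ (∈-++ˡ⁻ B ⊥ x∈B))

  whiteToG : ∀ {B : Subset n} {w x} → PPath H (_∉ liftSet B) (ιG w) x → PPath G (_∉ B) (πG x) w
  whiteToG {B} {w} {x} p = walk-mono G (λ a∉ a∈ → a∉ (∈-++ˡ B ⊥ a∈))
    (subst (PPath G (λ a → ιG a ∉ liftSet B) (πG x)) (πG-ιG w) (walk-toG (walk-reverse H p) (onG-ιG w)))

  -- a force of G is a force of H (the white component of ιG w contains no
  -- further neighbour of ιG u, since that would give one in G)
  liftForce : ∀ {B u w} → Forces G B u w → Forces H (liftSet B) (ιG u) (ιG w)
  liftForce {B} {u} {w} (u∈B , w∉B , uw , unique) =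
    ∈-++ˡ B ⊥ u∈B , (λ w∈ → w∉B (∈-++ˡ⁻ B ⊥ w∈)) , trans (adj-GG u w) uw , unique′
    where
    unique′ : ∀ x → PPath H (_∉ liftSet B) (ιG w) x → Adj H (ιG u) x → x ≡ ιG w
    unique′ x p ux with view x
    ... | inj₁ (a , refl) = cong ιG (unique a (walk-reverse G (subst (λ a′ → PPath G (_∉ B) a′ w) (πG-ιG a) (whiteToG p)))
                                              (trans (sym (adj-GG u a)) ux))
    ... | inj₂ (b , refl) = ⊥-elim (walk-head G (whiteToG p) (subst (_∈ B) (trans (adj-GR⇒v ux) (sym (πG-ιR b))) u∈B))

  liftSteps : ∀ {S B} → Steps G S B → Steps H (liftSet S) (liftSet B)
  liftSteps done = done
  liftSteps (more (u , w , force , refl) rest) = more (ιG u , ιG w , liftForce force , liftSet-∪ _ w) (liftSteps rest)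

  Shadow : Subset (n + m) → Subset n → Set
  Shadow B C = (∀ a → ιG a ∈ B → a ∈ C) × (∀ b → ιR b ∈ B → v ∈ C)

  shadow-∪ : ∀ {B C w} → Shadow B C → (∀ a → w ≡ ιG a → a ∈ C) → (∀ b → w ≡ ιR b → v ∈ C) →
             Shadow (B ∪ ⁅ w ⁆) C
  shadow-∪ {B} {C} {w} (onG′ , onR) newG newR = onG″ , onR″
    where
    onG″ : ∀ a → ιG a ∈ B ∪ ⁅ w ⁆ → a ∈ C
    onG″ a a∈ with ∈-∪⁅⁆⁻ B w a∈
    ... | inj₁ a∈B = onG′ a a∈B
    ... | inj₂ a≡w = newG a (sym a≡w)
    onR″ : ∀ b → ιR b ∈ B ∪ ⁅ w ⁆ → v ∈ C
    onR″ b b∈ with ∈-∪⁅⁆⁻ B w b∈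
    ... | inj₁ b∈B = onR b b∈B
    ... | inj₂ b≡w = newR b (sym b≡w)

  shadow-mono : ∀ {B C C'} → (∀ {a} → a ∈ C → a ∈ C') → Shadow B C → Shadow B C'
  shadow-mono C⊆C' (onG′ , onR) = (λ a a∈B → C⊆C' (onG′ a a∈B)) , (λ b b∈B → C⊆C' (onR b b∈B))

  -- a forcing process of H finishing from B is followed in G from any shadow
  -- C of B: a force ιG a → ιG a' is a force in G (white walks of G are white
  -- in H) unless a' is already black; every other force involves R, where
  -- the shadow already contains v
  simulate : ∀ {B C} → Steps H B ⊤ → Shadow B C → Steps G C ⊤
  simulate {C = C} done shadow = subst (Steps G C) (⊆-antisym (λ _ → ∈⊤) (λ {a} _ → proj₁ shadow a ∈⊤)) done
  simulate {B} {C} (more (u , w , (u∈B , w∉B , uw , unique) , refl) rest) shadow with view u | view w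
  ... | inj₁ (a , refl) | inj₁ (a' , refl) with a' ∈ˢ? C
  ...   | yes a'∈C = simulate rest (shadow-∪ shadow (λ _ e → subst (_∈ C) (ιG-injective e) a'∈C) (λ _ e → ⊥-elim (ιG≢ιR e)))
  ...   | no  a'∉C = more (a , a' , forceG , refl)
                       (simulate rest (shadow-∪ (shadow-mono ∈-∪ˡ shadow)
                                         (λ _ e → subst (_∈ C ∪ ⁅ a' ⁆) (ιG-injective e) (∈-∪⁅⁆ a'))
                                         (λ _ e → ⊥-elim (ιG≢ιR e))))
    where
    forceG : Forces G C a a'
    forceG = proj₁ shadow a u∈B , a'∉C , trans (sym (adj-GG a a')) uw ,
             λ x p ax → ιG-injective (unique (ιG x) (walk-fromG (walk-mono G (λ x∉C x∈B → x∉C (proj₁ shadow _ x∈B)) p))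
                                              (trans (adj-GG a x) ax))
  simulate (more (u , w , (u∈B , _ , uw , _) , refl) rest) shadow | inj₁ (a , refl) | inj₂ (b , refl) =
    simulate rest (shadow-∪ shadow (λ _ e → ⊥-elim (ιG≢ιR (sym e)))
                                   (λ _ _ → subst (_∈ _) (adj-GR⇒v uw) (proj₁ shadow a u∈B)))
  simulate (more (u , w , (u∈B , _ , uw , _) , refl) rest) shadow | inj₂ (b , refl) | inj₁ (a , refl) =
    simulate rest (shadow-∪ shadow (λ _ e → subst (_∈ _) (trans (sym (adj-RG⇒v uw)) (ιG-injective e)) (proj₂ shadow b u∈B))
                                   (λ _ e → ⊥-elim (ιG≢ιR e)))
  simulate (more (u , w , (u∈B , _ , _ , _) , refl) rest) shadow | inj₂ (b , refl) | inj₂ (b' , refl) =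
    simulate rest (shadow-∪ shadow (λ _ e → ⊥-elim (ιG≢ιR (sym e))) (λ _ _ → proj₂ shadow b u∈B))

  -- a positive zero forcing set S = xs ++ ys of H yields one of G, namely
  -- xs, or xs ∪ {v} if ys is nonempty, which is no larger than S
  zfsToG : ∀ S → IsPZFSet H S → ∃[ S' ] (IsPZFSet G S' × ∣ S' ∣ ≤ ∣ S ∣)
  zfsToG S zfs with Vec.splitAt n S
  ... | xs , ys , refl with nonempty? ys
  ...   | yes (y , y∈ys) = xs ∪ ⁅ v ⁆ , simulate zfs shadow , size
    where
    shadow : Shadow (xs ++ ys) (xs ∪ ⁅ v ⁆)
    shadow = (λ a a∈ → ∈-∪ˡ (∈-++ˡ⁻ xs ys a∈)) , (λ _ _ → ∈-∪⁅⁆ v)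
    1≤∣ys∣ : 1 ≤ ∣ ys ∣
    1≤∣ys∣ = subst (_≤ ∣ ys ∣) (∣⁅x⁆∣≡1 y) (p⊆q⇒∣p∣≤∣q∣ (λ x∈ → subst (_∈ ys) (sym (x∈⁅y⁆⇒x≡y y x∈)) y∈ys))
    size : ∣ xs ∪ ⁅ v ⁆ ∣ ≤ ∣ xs ++ ys ∣
    size = begin
      ∣ xs ∪ ⁅ v ⁆ ∣      ≤⟨ ∣p∪q∣≤∣p∣+∣q∣ xs ⁅ v ⁆ ⟩
      ∣ xs ∣ + ∣ ⁅ v ⁆ ∣  ≡⟨ cong (∣ xs ∣ +_) (∣⁅x⁆∣≡1 v) ⟩
      ∣ xs ∣ + 1          ≤⟨ +-monoʳ-≤ ∣ xs ∣ 1≤∣ys∣ ⟩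
      ∣ xs ∣ + ∣ ys ∣     ≡⟨ sym (∣p++q∣ xs ys) ⟩
      ∣ xs ++ ys ∣        ∎
      where open ≤-Reasoning
  ...   | no  ys-empty = xs , simulate zfs ((λ a a∈ → ∈-++ˡ⁻ xs ys a∈) , (λ b b∈ → ⊥-elim (ys-empty (b , ∈-++ʳ⁻ xs ys b∈)))) ,
                         subst (∣ xs ∣ ≤_) (sym (∣p++q∣ xs ys)) (m≤m+n ∣ xs ∣ ∣ ys ∣)

  module WithTree (T-tree : IsTree T) where

    T-connected : ∀ y y' → PPath T (const Unit) y y'
    T-connected y y' = proj₁ (proj₂ T-tree) y y' unit unit

    T-acyclic : ¬ HasCycle T (const Unit)
    T-acyclic = proj₂ (proj₂ T-tree)

    toBase : ∀ x → PPath H (λ z → πG z ≡ πG x) x (ιG (πG x))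
    toBase x with view x
    ... | inj₁ (a , refl) = subst (PPath H (λ z → πG z ≡ πG (ιG a)) (ιG a)) (cong ιG (sym (πG-ιG a))) (here refl)
    ... | inj₂ (b , refl) = subst₂ (PPath H (λ z → πG z ≡ πG (ιR b))) (ιT-punchIn b)
            (trans ιT-t (cong ιG (sym (πG-ιR b))))
            (walk-mono H (λ z∈T → trans (πG-InT z∈T) (sym (πG-ιR b))) (walk-fromT (T-connected (punchIn t b) t)))

    -- a tree cover of G extends to H: T joins the tree containing v
    coverFromG : ∀ {k} → TreeCover G k → TreeCover H k
    coverFromG (c , trees) = c ∘ πG , λ i → nonempty i , connected i , acyclic i
      where
      nonempty : ∀ i → ∃[ x ] c (πG x) ≡ i
      nonempty i with proj₁ (trees i)
      ... | a , a∈i = ιG a , trans (cong c (πG-ιG a)) a∈i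
      connected : ∀ i x y → c (πG x) ≡ i → c (πG y) ≡ i → PPath H (λ z → c (πG z) ≡ i) x y
      connected i x y x∈i y∈i =
        walk-++ H (walk-mono H (λ e → trans (cong c e) x∈i) (toBase x))
          (walk-++ H (walk-fromG (walk-mono G (λ {a} a∈i → trans (cong c (πG-ιG a)) a∈i)
                                               (proj₁ (proj₂ (trees i)) _ _ x∈i y∈i)))
                     (walk-reverse H (walk-mono H (λ e → trans (cong c e) y∈i) (toBase y))))
      acyclic : ∀ i → ¬ HasCycle H (λ z → c (πG z) ≡ i)
      acyclic i cyc with cycle-split {λ z → c (πG z) ≡ i} cyc
      ... | inj₁ cycG = proj₂ (proj₂ (trees i)) (cycle-mono {K = G} {λ a → c (πG (ιG a)) ≡ i} (λ {a} e → trans (sym (cong c (πG-ιG a))) e) cycG)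
      ... | inj₂ cycT = T-acyclic cycT

    treeCoverNumber : ∀ k → IsTreeCoverNumber H k ⇔ IsTreeCoverNumber G k
    treeCoverNumber k = mk⇔ fromH fromG
      where
      fromH : IsTreeCoverNumber H k → IsTreeCoverNumber G k
      fromH (coverH , minH) with dropEmptyClasses G k (coverToG coverH)
      ... | k' , k'≤k , coverG = subst (TreeCover G) (≤-antisym k'≤k (minH k' (coverFromG coverG))) coverG ,
                                 λ j coverG' → minH j (coverFromG coverG')
      fromG : IsTreeCoverNumber G k → IsTreeCoverNumber H k
      fromG (coverG , minG) = coverFromG coverG , λ j coverH' →
        let (j' , j'≤j , coverG') = dropEmptyClasses G j (coverToG coverH') in ≤-trans (minG j' coverG') j'≤j


    -- once every vertex of G is black, some black vertex can force: follow
    -- T from v to a white vertex and take the first edge leaving X.  Its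
    -- black end u has no second neighbour in the white component of its
    -- white end w, since that would close a cycle of T through u.
    forceInT : ∀ (X : Subset (n + m)) → (∀ a → ιG a ∈ X) → ∀ {x} → x ∉ X →
               ∃[ u ] ∃[ w ] Forces H X u w
    forceInT X G⊆X {x} x∉X with view x
    ... | inj₁ (a , refl) = ⊥-elim (x∉X (G⊆X a))
    ... | inj₂ (b , refl)
      with exitEdge H X (subst₂ (PPath H InT) ιT-t (ιT-punchIn b) (walk-fromT (T-connected t (punchIn t b)))) (G⊆X v) x∉X
    ...   | u , w , u∈X , w∉X , uw = u , w , u∈X , w∉X , uw , unique
      where
      white-InT : ∀ {x} → x ∉ X → InT x
      white-InT {x} x∉X with view x
      ... | inj₁ (a , refl) = ⊥-elim (x∉X (G⊆X a))
      ... | inj₂ (b , refl) = inj₁ (onG-ιR b)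
      u-InT : InT u
      u-InT with view u | view w
      ... | inj₂ (b , refl) | _               = inj₁ (onG-ιR b)
      ... | inj₁ (a , refl) | inj₁ (a' , refl) = ⊥-elim (w∉X (G⊆X a'))
      ... | inj₁ (a , refl) | inj₂ (b , refl)  = inj₂ (cong ιG (adj-GR⇒v uw))
      cycle-InT : ∀ {x} → x ∉ X ⊎ x ≡ u → InT x
      cycle-InT (inj₁ x∉X) = white-InT x∉X
      cycle-InT (inj₂ refl) = u-InT
      unique : ∀ w' → PPath H (_∉ X) w w' → Adj H u w' → w' ≡ w
      unique w' p uw' with w' ≟ w
      ... | yes w'≡w = w'≡w
      ... | no  w'≢w = ⊥-elim (T-acyclic (cycle-toT (cycle-mono {K = H} {λ x → x ∉ X ⊎ x ≡ u} cycle-InT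
                          (cycleThrough H p (w'≢w ∘ sym) (λ u∉X → u∉X u∈X) uw uw'))))

    -- hence a process with G black completes; the fuel f bounds the number
    -- of white vertices
    completeInT : ∀ f (X : Subset (n + m)) → n + m ≤ f + ∣ X ∣ → (∀ a → ιG a ∈ X) → Steps H X ⊤
    completeInT f X bound G⊆X with all? (_∈ˢ? X)
    ... | yes all∈X = subst (Steps H X) (⊆-antisym (λ _ → ∈⊤) (λ {x} _ → all∈X x)) done
    ... | no  someWhite with ¬∀⟶∃¬ (n + m) _ (_∈ˢ? X) someWhite
    ...   | x , x∉X with forceInT X G⊆X x∉X | f
    ...     | _ , _ , _      | zero   = ⊥-elim (x∉X (subst (x ∈_) (sym (∣p∣≡n⇒p≡⊤ (≤-antisym (∣p∣≤n X) bound))) ∈⊤))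
    ...     | u , w , forces | suc f' = more (u , w , forces , refl) (completeInT f' (X ∪ ⁅ w ⁆) bound' (λ a → ∈-∪ˡ (G⊆X a)))
      where
      grows : ∣ X ∣ < ∣ X ∪ ⁅ w ⁆ ∣
      grows = p⊂q⇒∣p∣<∣q∣ (∈-∪ˡ , w , ∈-∪⁅⁆ w , proj₁ (proj₂ forces))
      bound' : n + m ≤ f' + ∣ X ∪ ⁅ w ⁆ ∣
      bound' = ≤-trans bound (≤-trans (≤-reflexive (sym (+-suc f' ∣ X ∣))) (+-monoʳ-≤ f' grows))

    zfsFromG : ∀ S → IsPZFSet G S → IsPZFSet H (liftSet S)
    zfsFromG S zfs = steps-++ (liftSteps zfs) (completeInT (n + m) _ (m≤m+n (n + m) _) (λ a → ∈-++ˡ ⊤ ⊥ ∈⊤))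

    zeroForcingNumber : ∀ k → IsZplus H k ⇔ IsZplus G k
    zeroForcingNumber k = mk⇔ fromH fromG
      where
      minimalG : (∀ S → IsPZFSet H S → k ≤ ∣ S ∣) → ∀ S → IsPZFSet G S → k ≤ ∣ S ∣
      minimalG minH S zfs = subst (k ≤_) (∣liftSet∣ S) (minH _ (zfsFromG S zfs))
      fromH : IsZplus H k → IsZplus G k
      fromH ((S , zfs , ∣S∣≡k) , minH) with zfsToG S zfs
      ... | S' , zfs' , ∣S'∣≤∣S∣ = (S' , zfs' , ≤-antisym (subst (∣ S' ∣ ≤_) ∣S∣≡k ∣S'∣≤∣S∣) (minimalG minH S' zfs')) ,
                                   minimalG minH
      fromG : IsZplus G k → IsZplus H k
      fromG ((S , zfs , ∣S∣≡k) , minG) = (liftSet S , zfsFromG S zfs , trans (∣liftSet∣ S) ∣S∣≡k) ,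
        λ S' zfs' → let (S'' , zfs'' , ∣S''∣≤∣S'∣) = zfsToG S' zfs' in ≤-trans (minG S'' zfs'') ∣S''∣≤∣S'∣

theorem6p8 : ∀ {n m : ℕ} (G : Graph n) (v : Fin n) (T : Graph (suc m)) (t : Fin (suc m)) →
    IsTree T →
    (∀ k → IsZplus (vertexSum G v T t) k ⇔ IsZplus G k) ×
    (∀ k → IsTreeCoverNumber (vertexSum G v T t) k ⇔ IsTreeCoverNumber G k)
theorem6p8 G v T t T-tree = zeroForcingNumber , treeCoverNumber
  where open VertexSum.WithTree G v T t T-tree
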